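{- Let $p$ be a prime and $m\ge1$. Let $d=p^{m-1}u_{m-1}+\cdots+pu_1+u_0\in\mathbb{Z}_{p^m}$ with $u_k\in\mathbb{Z}_p$, and suppose $u_0\neq0$. Then $d$ is invertible in $\mathbb{Z}_{p^m}$. Moreover, let $u_0^{ -1}\in\{1,\dots,p-1\}$ be the inverse of $u_0$ modulo $p$, and define integers $s_0=u_0^{ -1}\bmod p$, $w_0=u_0s_0\bmod p^m$, and for $k=1,\dots,m-1$: $$s_k=\Big(-u_0^{ -1}\big(u_ks_0+u_{k-1}s_1+\cdots+u_1s_{k-1}+\lfloor w_{k-1}/p\rfloor\big)\Big)\bmod p,$$ $$w_k=\big(u_ks_0+u_{k-1}s_1+\cdots+u_0s_k+\lfloor w_{k-1}/p\rfloor\big)\bmod p^m.$$ Then $d^{ -1}=p^{m-1}s_{m-1}+\cdots+ps_1+s_0$ in $\mathbb{Z}_{p^m}$.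
   Context: $\mathbb{Z}_n=\{0,1,\dots,n-1\}$ with arithmetic modulo $n$; elements regarded as integers in this range. Every $d\in\mathbb{Z}_{p^m}$ has a unique base-$p$ expansion $d=\sum_{k=0}^{m-1}p^ku_k$ with $u_k\in\mathbb{Z}_p$. $\lfloor x/y\rfloor$ is the integer quotient. -}

module Defs where

open import Data.Nat using (ℕ; zero; suc; _+_; _*_; _∸_; _^_; _/_; _%_)
open import Data.Nat.Base using (_≡ᵇ_)
open import Data.Bool using (if_then_else_)
open import Data.List using (map; upTo)
open import Data.Nat.ListAction using (sum)
open import Data.Product using (_×_; _,_; proj₁; proj₂)
open import Data.Integer as ℤ using (ℤ; +_)
import Data.Integer.DivMod as ℤDM

-- Reduction of a natural number modulo n (the representative in {0,…,n-1}).
-- Only ever used with n ≥ 1; for n = 0 it returns x unchanged (totality convention).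
_mod_ : ℕ → ℕ → ℕ
x mod zero    = x
x mod (suc n) = x % suc n

-- Integer quotient ⌊x/n⌋ (n ≥ 1; for n = 0 returns 0, never used).
_div_ : ℕ → ℕ → ℕ
x div zero    = 0
x div (suc n) = x / suc n

_modℤ_ : ℤ → ℕ → ℕ
x modℤ zero    = ℤ.∣ x ∣
x modℤ (suc n) = x ℤDM.%ℕ suc n

Σ< : ℕ → (ℕ → ℕ) → ℕ
Σ< n f = sum (map f (upTo n))

fromDigits : ℕ → ℕ → (ℕ → ℕ) → ℕ
fromDigits p m a = Σ< m (λ k → p ^ k * a k)

conv : (ℕ → ℕ) → (ℕ → ℕ) → ℕ → ℕ → ℕ
conv u s k n = Σ< n (λ j → u (k ∸ j) * s j)

-- Parameters: p, m, digits u, and inv = u_0^{-1} ∈ {1,…,p-1}.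
-- sw k = (s, w_k) where s j = s_j for all j ≤ k.
--   s_0 = inv mod p,   w_0 = (u_0 s_0) mod p^m,
--   s_k = (-inv · (u_k s_0 + … + u_1 s_{k-1} + ⌊w_{k-1}/p⌋)) mod p,
--   w_k = (u_k s_0 + … + u_0 s_k + ⌊w_{k-1}/p⌋) mod p^m.
sw : (p m : ℕ) → (u : ℕ → ℕ) → (inv : ℕ) → ℕ → (ℕ → ℕ) × ℕ
sw p m u inv zero = (λ _ → s₀) , ((u 0 * s₀) mod (p ^ m))
  where s₀ = inv mod p
sw p m u inv (suc k) = s' , w'
  where
    prev  = sw p m u inv k
    s     = proj₁ prev
    carry = proj₂ prev div p
    sk    = (ℤ.- (+ inv) ℤ.* (+ (conv u s (suc k) (suc k) + carry))) modℤ p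
    s'    : ℕ → ℕ
    s' j  = if j ≡ᵇ suc k then sk else s j
    w'    = (conv u s' (suc k) (suc (suc k)) + carry) mod (p ^ m)

sSeq : (p m : ℕ) → (u : ℕ → ℕ) → (inv : ℕ) → ℕ → ℕ
sSeq p m u inv k = proj₁ (sw p m u inv k) k

-- Multiplying d by the candidate inverse digit by digit, the t-th column of the schoolbook
-- product is c_t = u_t s_0 + … + u_0 s_t, and w_t is that column plus the carry from column
-- t - 1.  The digit s_t is chosen exactly so that w_t ≡ 0 (mod p) for t ≥ 1, while
-- w_0 = u_0 u_0⁻¹ ≡ 1; hence Σ_{t≤k} p^t c_t ≡ 1 + p^{k+1} ⌊w_k/p⌋ (mod p^m) for every k.
-- At k = m - 1 the carry term vanishes mod p^m, and the truncated Cauchy product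
-- Σ_{t<m} p^t c_t agrees with d · Σ_{t<m} p^t s_t mod p^m.  Inverses mod p^m are unique.
module Submission where

open import Defs
open import Data.Nat using (ℕ; _+_; _*_; _^_; _≤_; _<_)
open import Data.Nat.Primality using (Prime)
open import Data.Product using (Σ; _×_)
open import Relation.Binary.PropositionalEquality using (_≡_; _≢_)

open import Data.Nat.Base
  using (zero; suc; _∸_; _/_; _%_; NonZero; _≡ᵇ_; _≤′_; ≤′-refl; ≤′-step; z≤n; s≤s; s≤s⁻¹)
open import Data.Nat.Properties
open import Data.Nat.DivMod using (m≡m%n+[m/n]*n; m%n%n≡m%n; [m+kn]%n≡m%n; m%n<n; m<n⇒m%n≡m; m*n%n≡0;
  %-distribˡ-+; %-distribˡ-*; m∣n⇒o%n%m≡o%m)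
open import Data.Nat.Divisibility using (_∣_; m∣m*n)
open import Data.Nat.Primality using (prime⇒nonZero)
open import Data.Nat.ListAction.Properties using (sum-++)
open import Data.Nat.Solver using (module +-*-Solver)
open import Data.Bool using (false; if_then_else_)
open import Data.List using ([_]; _++_; map; upTo)
open import Data.Nat.ListAction using (sum)
open import Data.List.Properties using (upTo-∷ʳ; map-++)
open import Data.Product using (_,_; proj₁; proj₂)
import Data.Integer as ℤ
import Data.Integer.DivMod as ℤDM
import Data.Integer.Properties as ℤP
import Data.Integer.Solver as ℤSolver
open import Function using (_∘_)
open import Relation.Binary.PropositionalEquality using (refl; sym; trans; cong; cong₂; subst; module ≡-Reasoning)

open ≡-Reasoning

Σ<-suc : ∀ n f → Σ< (suc n) f ≡ Σ< n f + f n
Σ<-suc n f = begin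
  sum (map f (upTo (suc n)))      ≡⟨ cong (sum ∘ map f) (upTo-∷ʳ n) ⟨
  sum (map f (upTo n ++ [ n ]))   ≡⟨ cong sum (map-++ f (upTo n) [ n ]) ⟩
  sum (map f (upTo n) ++ [ f n ]) ≡⟨ sum-++ (map f (upTo n)) [ f n ] ⟩
  Σ< n f + (f n + 0)              ≡⟨ cong (Σ< n f +_) (+-identityʳ (f n)) ⟩
  Σ< n f + f n                    ∎

Σ<-cong : ∀ n {f g : ℕ → ℕ} → (∀ j → j < n → f j ≡ g j) → Σ< n f ≡ Σ< n g
Σ<-cong zero    f≡g = refl
Σ<-cong (suc n) {f} {g} f≡g = begin
  Σ< (suc n) f ≡⟨ Σ<-suc n f ⟩
  Σ< n f + f n ≡⟨ cong₂ _+_ (Σ<-cong n (λ j j<n → f≡g j (m<n⇒m<1+n j<n))) (f≡g n ≤-refl) ⟩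
  Σ< n g + g n ≡⟨ Σ<-suc n g ⟨
  Σ< (suc n) g ∎

Σ<-+ : ∀ n (f g : ℕ → ℕ) → Σ< n (λ j → f j + g j) ≡ Σ< n f + Σ< n g
Σ<-+ zero    f g = refl
Σ<-+ (suc n) f g = begin
  Σ< (suc n) (λ j → f j + g j)     ≡⟨ Σ<-suc n _ ⟩
  Σ< n (λ j → f j + g j) + (f n + g n) ≡⟨ cong (_+ (f n + g n)) (Σ<-+ n f g) ⟩
  Σ< n f + Σ< n g + (f n + g n)    ≡⟨ solve 4 (λ a b c d → a :+ b :+ (c :+ d) := a :+ c :+ (b :+ d))
                                         refl (Σ< n f) (Σ< n g) (f n) (g n) ⟩
  (Σ< n f + f n) + (Σ< n g + g n)  ≡⟨ sym (cong₂ _+_ (Σ<-suc n f) (Σ<-suc n g)) ⟩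
  Σ< (suc n) f + Σ< (suc n) g      ∎
  where open +-*-Solver

*-distribˡ-Σ< : ∀ n c (f : ℕ → ℕ) → Σ< n (λ j → c * f j) ≡ c * Σ< n f
*-distribˡ-Σ< zero    c f = sym (*-zeroʳ c)
*-distribˡ-Σ< (suc n) c f = begin
  Σ< (suc n) (λ j → c * f j)  ≡⟨ Σ<-suc n _ ⟩
  Σ< n (λ j → c * f j) + c * f n ≡⟨ cong (_+ c * f n) (*-distribˡ-Σ< n c f) ⟩
  c * Σ< n f + c * f n        ≡⟨ *-distribˡ-+ c (Σ< n f) (f n) ⟨
  c * (Σ< n f + f n)          ≡⟨ cong (c *_) (Σ<-suc n f) ⟨
  c * Σ< (suc n) f            ∎

m^n*m^[o∸n]≡m^o : ∀ m {n o} → n ≤ o → m ^ n * m ^ (o ∸ n) ≡ m ^ o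
m^n*m^[o∸n]≡m^o m {n} n≤o = trans (sym (^-distribˡ-+-* m n _)) (cong (m ^_) (m+[n∸m]≡n n≤o))

fromDigits-< : ∀ {p n} {a : ℕ → ℕ} → (∀ j → j < n → a j < p) → fromDigits p n a < p ^ n
fromDigits-< {p} {zero}  a<p = s≤s z≤n
fromDigits-< {p} {suc n} {a} a<p =
  subst (_< p ^ suc n) (sym (Σ<-suc n _)) (<-≤-trans (+-monoˡ-< (p ^ n * a n) IH) top-column)
  where
  IH : fromDigits p n a < p ^ n
  IH = fromDigits-< (λ j j<n → a<p j (m<n⇒m<1+n j<n))
  top-column : p ^ n + p ^ n * a n ≤ p ^ suc n
  top-column = ≤-trans (≤-reflexive (sym (*-suc (p ^ n) (a n))))
                 (≤-trans (*-monoʳ-≤ (p ^ n) (a<p n ≤-refl)) (≤-reflexive (*-comm (p ^ n) p)))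

fromDigits-+ : ∀ p r l (a : ℕ → ℕ) →
  fromDigits p (r + l) a ≡ fromDigits p l a + p ^ l * fromDigits p r (λ i → a (l + i))
fromDigits-+ p zero    l a = sym (trans (cong (fromDigits p l a +_) (*-zeroʳ (p ^ l))) (+-identityʳ _))
fromDigits-+ p (suc r) l a = begin
  fromDigits p (suc r + l) a                          ≡⟨ Σ<-suc (r + l) _ ⟩
  fromDigits p (r + l) a + p ^ (r + l) * a (r + l)    ≡⟨ cong₂ _+_ (fromDigits-+ p r l a) top-digit ⟩
  A + p ^ l * R + p ^ l * (p ^ r * a (l + r))         ≡⟨ +-assoc A _ _ ⟩
  A + (p ^ l * R + p ^ l * (p ^ r * a (l + r)))       ≡⟨ cong (A +_) (*-distribˡ-+ (p ^ l) R _) ⟨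
  A + p ^ l * (R + p ^ r * a (l + r))                 ≡⟨ cong (λ x → A + p ^ l * x) (Σ<-suc r _) ⟨
  A + p ^ l * fromDigits p (suc r) (λ i → a (l + i))  ∎
  where
  A = fromDigits p l a
  R = fromDigits p r (λ i → a (l + i))
  top-digit : p ^ (r + l) * a (r + l) ≡ p ^ l * (p ^ r * a (l + r))
  top-digit = begin
    p ^ (r + l) * a (r + l)   ≡⟨ cong (λ i → p ^ i * a i) (+-comm r l) ⟩
    p ^ (l + r) * a (l + r)   ≡⟨ cong (_* a (l + r)) (^-distribˡ-+-* p l r) ⟩
    p ^ l * p ^ r * a (l + r) ≡⟨ *-assoc (p ^ l) (p ^ r) (a (l + r)) ⟩
    p ^ l * (p ^ r * a (l + r)) ∎

cauchyProduct : ℕ → ℕ → (ℕ → ℕ) → (ℕ → ℕ) → ℕ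
cauchyProduct p n a b = Σ< n (λ t → p ^ t * conv a b t (suc t))

cauchyProduct≡Σ : ∀ p n (a b : ℕ → ℕ) →
  cauchyProduct p n a b ≡ Σ< n (λ j → fromDigits p (n ∸ j) a * (p ^ j * b j))
cauchyProduct≡Σ p zero    a b = refl
cauchyProduct≡Σ p (suc n) a b = begin
  cauchyProduct p (suc n) a b                          ≡⟨ Σ<-suc n _ ⟩
  cauchyProduct p n a b + p ^ n * conv a b n (suc n)
    ≡⟨ cong₂ (λ x y → x + p ^ n * y) (cauchyProduct≡Σ p n a b) (Σ<-suc n _) ⟩
  S n + p ^ n * (conv a b n n + a (n ∸ n) * b n)
    ≡⟨ cong (λ i → S n + p ^ n * (conv a b n n + a i * b n)) (n∸n≡0 n) ⟩
  S n + p ^ n * (conv a b n n + a 0 * b n)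
    ≡⟨ solve 5 (λ x q c a₀ bₙ → x :+ q :* (c :+ a₀ :* bₙ) := x :+ q :* c :+ (con 1 :* a₀ :+ con 0) :* (q :* bₙ))
         refl (S n) (p ^ n) (conv a b n n) (a 0) (b n) ⟩
  S n + p ^ n * conv a b n n + fromDigits p 1 a * (p ^ n * b n)
    ≡⟨ cong₂ _+_ (sym Σ-term-suc) (cong (λ i → fromDigits p i a * (p ^ n * b n)) (sym (m+n∸n≡m 1 n))) ⟩
  Σ< n (T (suc n)) + T (suc n) n                       ≡⟨ Σ<-suc n _ ⟨
  S (suc n)                                            ∎
  where
  open +-*-Solver
  T : ℕ → ℕ → ℕ
  T k j = fromDigits p (k ∸ j) a * (p ^ j * b j)
  S : ℕ → ℕ
  S k = Σ< k (T k)
  term-suc : ∀ j → j < n → T (suc n) j ≡ T n j + p ^ n * (a (n ∸ j) * b j)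
  term-suc j j<n = begin
    fromDigits p (suc n ∸ j) a * (p ^ j * b j)
      ≡⟨ cong (λ i → fromDigits p i a * (p ^ j * b j)) (+-∸-assoc 1 (<⇒≤ j<n)) ⟩
    fromDigits p (suc (n ∸ j)) a * (p ^ j * b j)
      ≡⟨ cong (_* (p ^ j * b j)) (Σ<-suc (n ∸ j) _) ⟩
    (fromDigits p (n ∸ j) a + p ^ (n ∸ j) * a (n ∸ j)) * (p ^ j * b j)
      ≡⟨ solve 5 (λ x q aᵢ r bⱼ → (x :+ q :* aᵢ) :* (r :* bⱼ) := x :* (r :* bⱼ) :+ (r :* q) :* (aᵢ :* bⱼ))
           refl (fromDigits p (n ∸ j) a) (p ^ (n ∸ j)) (a (n ∸ j)) (p ^ j) (b j) ⟩
    T n j + p ^ j * p ^ (n ∸ j) * (a (n ∸ j) * b j)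
      ≡⟨ cong (λ q → T n j + q * (a (n ∸ j) * b j)) (m^n*m^[o∸n]≡m^o p (<⇒≤ j<n)) ⟩
    T n j + p ^ n * (a (n ∸ j) * b j) ∎
  Σ-term-suc : Σ< n (T (suc n)) ≡ S n + p ^ n * conv a b n n
  Σ-term-suc = trans (Σ<-cong n term-suc) (trans (Σ<-+ n _ _) (cong (S n +_) (*-distribˡ-Σ< n (p ^ n) _)))

fromDigits-*-% : ∀ p n (a b : ℕ → ℕ) .{{_ : NonZero (p ^ n)}} →
  (fromDigits p n a * fromDigits p n b) % p ^ n ≡ cauchyProduct p n a b % p ^ n
fromDigits-*-% p n a b = begin
  (A * fromDigits p n b) % p ^ n
    ≡⟨ cong (_% p ^ n) (*-distribˡ-Σ< n A _) ⟨
  Σ< n (λ j → A * (p ^ j * b j)) % p ^ n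
    ≡⟨ cong (_% p ^ n) (trans (Σ<-cong n split) (Σ<-+ n _ _)) ⟩
  (Σ< n (λ j → fromDigits p (n ∸ j) a * (p ^ j * b j)) + Σ< n (λ j → p ^ n * (R j * b j))) % p ^ n
    ≡⟨ cong₂ (λ x y → (x + y) % p ^ n) (sym (cauchyProduct≡Σ p n a b)) (*-distribˡ-Σ< n (p ^ n) _) ⟩
  (cauchyProduct p n a b + p ^ n * Σ< n (λ j → R j * b j)) % p ^ n
    ≡⟨ cong (λ x → (cauchyProduct p n a b + x) % p ^ n) (*-comm (p ^ n) _) ⟩
  (cauchyProduct p n a b + Σ< n (λ j → R j * b j) * p ^ n) % p ^ n
    ≡⟨ [m+kn]%n≡m%n (cauchyProduct p n a b) (Σ< n (λ j → R j * b j)) (p ^ n) ⟩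
  cauchyProduct p n a b % p ^ n ∎
  where
  open +-*-Solver
  A = fromDigits p n a
  R : ℕ → ℕ
  R j = fromDigits p j (λ i → a ((n ∸ j) + i))
  split : ∀ j → j < n → A * (p ^ j * b j) ≡ fromDigits p (n ∸ j) a * (p ^ j * b j) + p ^ n * (R j * b j)
  split j j<n = begin
    A * (p ^ j * b j)
      ≡⟨ cong (λ i → fromDigits p i a * (p ^ j * b j)) (m+[n∸m]≡n (<⇒≤ j<n)) ⟨
    fromDigits p (j + (n ∸ j)) a * (p ^ j * b j)
      ≡⟨ cong (_* (p ^ j * b j)) (fromDigits-+ p j (n ∸ j) a) ⟩
    (fromDigits p (n ∸ j) a + p ^ (n ∸ j) * R j) * (p ^ j * b j)
      ≡⟨ solve 5 (λ x q r pⱼ bⱼ → (x :+ q :* r) :* (pⱼ :* bⱼ) := x :* (pⱼ :* bⱼ) :+ (pⱼ :* q) :* (r :* bⱼ))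
           refl (fromDigits p (n ∸ j) a) (p ^ (n ∸ j)) (R j) (p ^ j) (b j) ⟩
    fromDigits p (n ∸ j) a * (p ^ j * b j) + p ^ j * p ^ (n ∸ j) * (R j * b j)
      ≡⟨ cong (λ q → fromDigits p (n ∸ j) a * (p ^ j * b j) + q * (R j * b j)) (m^n*m^[o∸n]≡m^o p (<⇒≤ j<n)) ⟩
    fromDigits p (n ∸ j) a * (p ^ j * b j) + p ^ n * (R j * b j) ∎

mod≡% : ∀ x n .{{_ : NonZero n}} → x mod n ≡ x % n
mod≡% x (suc n) = refl

div≡/ : ∀ x n .{{_ : NonZero n}} → x div n ≡ x / n
div≡/ x (suc n) = refl

modℤ≡%ℕ : ∀ x n .{{_ : NonZero n}} → x modℤ n ≡ x ℤDM.%ℕ n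
modℤ≡%ℕ x (suc n) = refl

%-cong-+ : ∀ {a a′ b b′} d .{{_ : NonZero d}} → a % d ≡ a′ % d → b % d ≡ b′ % d → (a + b) % d ≡ (a′ + b′) % d
%-cong-+ {a} {a′} {b} {b′} d a≡a′ b≡b′ = begin
  (a + b) % d             ≡⟨ %-distribˡ-+ a b d ⟩
  (a % d + b % d) % d     ≡⟨ cong₂ (λ x y → (x + y) % d) a≡a′ b≡b′ ⟩
  (a′ % d + b′ % d) % d   ≡⟨ %-distribˡ-+ a′ b′ d ⟨
  (a′ + b′) % d           ∎

m*[n%d]%d≡m*n%d : ∀ m n d .{{_ : NonZero d}} → (m * (n % d)) % d ≡ (m * n) % d
m*[n%d]%d≡m*n%d m n d = begin
  (m * (n % d)) % d           ≡⟨ %-distribˡ-* m (n % d) d ⟩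
  (m % d * (n % d % d)) % d   ≡⟨ cong (λ x → (m % d * x) % d) (m%n%n≡m%n n d) ⟩
  (m % d * (n % d)) % d       ≡⟨ %-distribˡ-* m n d ⟨
  (m * n) % d                 ∎

%-inverse-unique : ∀ {d e e′ n} .{{_ : NonZero n}} → e < n → e′ < n →
  (d * e) % n ≡ 1 → (d * e′) % n ≡ 1 → e ≡ e′
%-inverse-unique {d} {e} {e′} {n} e<n e′<n de≡1 de′≡1 = begin
  e                       ≡⟨ m<n⇒m%n≡m e<n ⟨
  e % n                   ≡⟨ cong (_% n) (*-identityʳ e) ⟨
  (e * 1) % n             ≡⟨ cong (λ x → (e * x) % n) de′≡1 ⟨
  (e * ((d * e′) % n)) % n ≡⟨ m*[n%d]%d≡m*n%d e (d * e′) n ⟩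
  (e * (d * e′)) % n      ≡⟨ cong (_% n) (solve 3 (λ x y z → x :* (y :* z) := z :* (y :* x)) refl e d e′) ⟩
  (e′ * (d * e)) % n      ≡⟨ m*[n%d]%d≡m*n%d e′ (d * e) n ⟨
  (e′ * ((d * e) % n)) % n ≡⟨ cong (λ x → (e′ * x) % n) de≡1 ⟩
  (e′ * 1) % n            ≡⟨ cong (_% n) (*-identityʳ e′) ⟩
  e′ % n                  ≡⟨ m<n⇒m%n≡m e′<n ⟩
  e′                      ∎
  where open +-*-Solver

p^k*x≡p^k*[x%p]+p^[1+k]*[x/p] : ∀ p .{{_ : NonZero p}} k x → p ^ k * x ≡ p ^ k * (x % p) + p ^ suc k * (x / p)
p^k*x≡p^k*[x%p]+p^[1+k]*[x/p] p k x = begin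
  p ^ k * x                             ≡⟨ cong (p ^ k *_) (m≡m%n+[m/n]*n x p) ⟩
  p ^ k * (x % p + x / p * p)           ≡⟨ solve 4 (λ q r c pp → q :* (r :+ c :* pp) := q :* r :+ pp :* q :* c)
                                             refl (p ^ k) (x % p) (x / p) p ⟩
  p ^ k * (x % p) + p ^ suc k * (x / p) ∎
  where open +-*-Solver

X+a*[-iX%p]%p≡0 : ∀ p .{{_ : NonZero p}} a i → (a * i) % p ≡ 1 →
  ∀ X → (X + a * ((ℤ.- (ℤ.+ i) ℤ.* ℤ.+ X) ℤDM.%ℕ p)) % p ≡ 0
X+a*[-iX%p]%p≡0 p a i ai≡1 X = begin
  (X + a * digit) % p  ≡⟨ cong (_% p) (trans (cong ℤ.∣_∣ (sym multiple)) (ℤP.abs-* z (ℤ.+ p))) ⟩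
  (ℤ.∣ z ∣ * p) % p    ≡⟨ m*n%n≡0 ℤ.∣ z ∣ p ⟩
  0                    ∎
  where
  open ℤSolver.+-*-Solver
  A = ℤ.- (ℤ.+ i) ℤ.* ℤ.+ X
  digit = A ℤDM.%ℕ p
  q = A ℤDM./ℕ p
  r = (a * i) / p
  z = ℤ.- (ℤ.+ X ℤ.* ℤ.+ r ℤ.+ ℤ.+ a ℤ.* q)
  ai≡1+rp : ℤ.+ a ℤ.* ℤ.+ i ≡ ℤ.+ 1 ℤ.+ ℤ.+ r ℤ.* ℤ.+ p
  ai≡1+rp = begin
    ℤ.+ a ℤ.* ℤ.+ i           ≡⟨ ℤP.pos-* a i ⟨
    ℤ.+ (a * i)               ≡⟨ cong ℤ.+_ (trans (m≡m%n+[m/n]*n (a * i) p) (cong (_+ r * p) ai≡1)) ⟩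
    ℤ.+ (1 + r * p)           ≡⟨ trans (ℤP.pos-+ 1 (r * p)) (cong (λ y → ℤ.+ 1 ℤ.+ y) (ℤP.pos-* r p)) ⟩
    ℤ.+ 1 ℤ.+ ℤ.+ r ℤ.* ℤ.+ p ∎
  multiple : z ℤ.* ℤ.+ p ≡ ℤ.+ (X + a * digit)
  multiple = begin
    z ℤ.* ℤ.+ p
      ≡⟨ solve 5 (λ x r′ a′ q′ p′ → :- (x :* r′ :+ a′ :* q′) :* p′ := x :- (con (ℤ.+ 1) :+ r′ :* p′) :* x :- a′ :* q′ :* p′)
           refl (ℤ.+ X) (ℤ.+ r) (ℤ.+ a) q (ℤ.+ p) ⟩
    ℤ.+ X ℤ.- (ℤ.+ 1 ℤ.+ ℤ.+ r ℤ.* ℤ.+ p) ℤ.* ℤ.+ X ℤ.- ℤ.+ a ℤ.* q ℤ.* ℤ.+ p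
      ≡⟨ cong (λ y → ℤ.+ X ℤ.- y ℤ.* ℤ.+ X ℤ.- ℤ.+ a ℤ.* q ℤ.* ℤ.+ p) ai≡1+rp ⟨
    ℤ.+ X ℤ.- (ℤ.+ a ℤ.* ℤ.+ i) ℤ.* ℤ.+ X ℤ.- ℤ.+ a ℤ.* q ℤ.* ℤ.+ p
      ≡⟨ solve 5 (λ x a′ i′ q′ p′ → x :- (a′ :* i′) :* x :- a′ :* q′ :* p′ := x :+ a′ :* ((:- i′ :* x) :- q′ :* p′))
           refl (ℤ.+ X) (ℤ.+ a) (ℤ.+ i) q (ℤ.+ p) ⟩
    ℤ.+ X ℤ.+ ℤ.+ a ℤ.* (A ℤ.- q ℤ.* ℤ.+ p)
      ≡⟨ cong (λ y → ℤ.+ X ℤ.+ ℤ.+ a ℤ.* (y ℤ.- q ℤ.* ℤ.+ p)) (ℤDM.a≡a%ℕn+[a/ℕn]*n A p) ⟩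
    ℤ.+ X ℤ.+ ℤ.+ a ℤ.* (ℤ.+ digit ℤ.+ q ℤ.* ℤ.+ p ℤ.- q ℤ.* ℤ.+ p)
      ≡⟨ cong (λ y → ℤ.+ X ℤ.+ ℤ.+ a ℤ.* y) (solve 2 (λ d t → d :+ t :- t := d) refl (ℤ.+ digit) (q ℤ.* ℤ.+ p)) ⟩
    ℤ.+ X ℤ.+ ℤ.+ a ℤ.* ℤ.+ digit
      ≡⟨ trans (ℤP.pos-+ X (a * digit)) (cong (λ y → ℤ.+ X ℤ.+ y) (ℤP.pos-* a digit)) ⟨
    ℤ.+ (X + a * digit) ∎

if-≡ᵇ-refl : ∀ {A : Set} n (x y : A) → (if n ≡ᵇ n then x else y) ≡ x
if-≡ᵇ-refl zero    x y = refl
if-≡ᵇ-refl (suc n) x y = if-≡ᵇ-refl n x y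

≤⇒≡ᵇ-suc-false : ∀ {j k} → j ≤ k → (j ≡ᵇ suc k) ≡ false
≤⇒≡ᵇ-suc-false z≤n       = refl
≤⇒≡ᵇ-suc-false (s≤s j≤k) = ≤⇒≡ᵇ-suc-false j≤k

module Inverse (p m′ : ℕ) .{{_ : NonZero p}} (u : ℕ → ℕ) (inv : ℕ) (u₀inv≡1 : (u 0 * inv) % p ≡ 1) where

  m N : ℕ
  m = suc m′
  N = p ^ m

  instance
    N≢0 : NonZero N
    N≢0 = m^n≢0 p m

  s : ℕ → ℕ
  s = sSeq p m u inv

  w : ℕ → ℕ
  w k = proj₂ (sw p m u inv k)

  prefix : ℕ → ℕ → ℕ
  prefix k = proj₁ (sw p m u inv k)

  prefix-stable : ∀ {j k} → j ≤ k → prefix k j ≡ s j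
  prefix-stable j≤k = go (≤⇒≤′ j≤k)
    where
    go : ∀ {j k} → j ≤′ k → prefix k j ≡ s j
    go ≤′-refl                   = refl
    go {j} {suc k} (≤′-step j≤′k) rewrite ≤⇒≡ᵇ-suc-false (≤′⇒≤ j≤′k) = go j≤′k

  conv-prefix : ∀ k t n → n ≤ suc k → conv u (prefix k) t n ≡ conv u s t n
  conv-prefix k t n n≤1+k =
    Σ<-cong n (λ j j<n → cong (u (t ∸ j) *_) (prefix-stable (s≤s⁻¹ (≤-trans j<n n≤1+k))))

  s-suc : ∀ k → s (suc k) ≡ (ℤ.- (ℤ.+ inv) ℤ.* ℤ.+ (conv u s (suc k) (suc k) + w k / p)) ℤDM.%ℕ p
  s-suc k = begin
    s (suc k)
      ≡⟨ if-≡ᵇ-refl k _ _ ⟩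
    (ℤ.- (ℤ.+ inv) ℤ.* ℤ.+ (conv u (prefix k) (suc k) (suc k) + w k div p)) modℤ p
      ≡⟨ cong₂ (λ x y → (ℤ.- (ℤ.+ inv) ℤ.* ℤ.+ (x + y)) modℤ p) (conv-prefix k (suc k) (suc k) ≤-refl) (div≡/ (w k) p) ⟩
    (ℤ.- (ℤ.+ inv) ℤ.* ℤ.+ (conv u s (suc k) (suc k) + w k / p)) modℤ p
      ≡⟨ modℤ≡%ℕ _ p ⟩
    (ℤ.- (ℤ.+ inv) ℤ.* ℤ.+ (conv u s (suc k) (suc k) + w k / p)) ℤDM.%ℕ p ∎

  w-suc : ∀ k → w (suc k) ≡ (conv u s (suc k) (suc (suc k)) + w k / p) % N
  w-suc k = begin
    w (suc k)
      ≡⟨ cong₂ (λ x y → (x + y) mod N) (conv-prefix (suc k) (suc k) (suc (suc k)) ≤-refl) (div≡/ (w k) p) ⟩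
    (conv u s (suc k) (suc (suc k)) + w k / p) mod N
      ≡⟨ mod≡% _ N ⟩
    (conv u s (suc k) (suc (suc k)) + w k / p) % N ∎

  s<p : ∀ j → s j < p
  s<p zero    = subst (_< p) (sym (mod≡% inv p)) (m%n<n inv p)
  s<p (suc k) = subst (_< p) (sym (s-suc k)) (ℤDM.n%ℕd<d (ℤ.- (ℤ.+ inv) ℤ.* ℤ.+ (conv u s (suc k) (suc k) + w k / p)) p)

  p∣N : p ∣ N
  p∣N = m∣m*n (p ^ m′)

  1<N : 1 < N
  1<N = subst (_< N) u₀inv≡1 (<-≤-trans (m%n<n (u 0 * inv) p) (m≤m*n p (p ^ m′) {{m^n≢0 p m′}}))

  w₀%p≡1 : w 0 % p ≡ 1
  w₀%p≡1 = begin
    ((u 0 * (inv mod p)) mod N) % p  ≡⟨ cong (λ x → ((u 0 * x) mod N) % p) (mod≡% inv p) ⟩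
    ((u 0 * (inv % p)) mod N) % p    ≡⟨ cong (_% p) (mod≡% _ N) ⟩
    (u 0 * (inv % p)) % N % p        ≡⟨ m∣n⇒o%n%m≡o%m p N _ p∣N ⟩
    (u 0 * (inv % p)) % p            ≡⟨ m*[n%d]%d≡m*n%d (u 0) inv p ⟩
    (u 0 * inv) % p                  ≡⟨ u₀inv≡1 ⟩
    1                                ∎

  w-suc%p≡0 : ∀ k → w (suc k) % p ≡ 0
  w-suc%p≡0 k = begin
    w (suc k) % p                                 ≡⟨ cong (_% p) (w-suc k) ⟩
    (conv u s (suc k) (suc (suc k)) + carry) % N % p  ≡⟨ m∣n⇒o%n%m≡o%m p N _ p∣N ⟩
    (conv u s (suc k) (suc (suc k)) + carry) % p
      ≡⟨ cong (λ x → (x + carry) % p) (Σ<-suc (suc k) (λ j → u (suc k ∸ j) * s j)) ⟩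
    (X₀ + u (k ∸ k) * s (suc k) + carry) % p      ≡⟨ cong (λ i → (X₀ + u i * s (suc k) + carry) % p) (n∸n≡0 k) ⟩
    (X₀ + u 0 * s (suc k) + carry) % p
      ≡⟨ cong (_% p) (solve 3 (λ x y c → x :+ y :+ c := x :+ c :+ y) refl X₀ _ carry) ⟩
    (X₀ + carry + u 0 * s (suc k)) % p            ≡⟨ cong (λ d → (X₀ + carry + u 0 * d) % p) (s-suc k) ⟩
    (X₀ + carry + u 0 * _) % p                    ≡⟨ X+a*[-iX%p]%p≡0 p (u 0) inv u₀inv≡1 (X₀ + carry) ⟩
    0                                             ∎
    where
    open +-*-Solver
    carry = w k / p
    X₀ = conv u s (suc k) (suc k)

  cauchyProduct-invariant : ∀ k → cauchyProduct p (suc k) u s % N ≡ (1 + p ^ suc k * (w k / p)) % N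
  cauchyProduct-invariant zero = begin
    (1 * (u 0 * s 0 + 0) + 0) % N
      ≡⟨ cong (_% N) (solve 1 (λ x → con 1 :* (x :+ con 0) :+ con 0 := x) refl (u 0 * s 0)) ⟩
    (u 0 * s 0) % N                ≡⟨ m%n%n≡m%n _ N ⟨
    (u 0 * s 0) % N % N            ≡⟨ cong (_% N) (mod≡% _ N) ⟨
    w 0 % N                        ≡⟨ cong (_% N) (*-identityˡ (w 0)) ⟨
    (p ^ 0 * w 0) % N              ≡⟨ cong (_% N) (p^k*x≡p^k*[x%p]+p^[1+k]*[x/p] p 0 (w 0)) ⟩
    (1 * (w 0 % p) + p ^ 1 * (w 0 / p)) % N ≡⟨ cong (λ r → (1 * r + p ^ 1 * (w 0 / p)) % N) w₀%p≡1 ⟩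
    (1 + p ^ 1 * (w 0 / p)) % N    ∎
    where open +-*-Solver
  cauchyProduct-invariant (suc k) = begin
    cauchyProduct p (suc (suc k)) u s % N     ≡⟨ cong (_% N) (Σ<-suc (suc k) (λ t → p ^ t * conv u s t (suc t))) ⟩
    (cauchyProduct p (suc k) u s + q * c) % N ≡⟨ %-cong-+ N (cauchyProduct-invariant k) refl ⟩
    (1 + q * carry + q * c) % N
      ≡⟨ cong (_% N) (solve 3 (λ q′ a b → con 1 :+ q′ :* a :+ q′ :* b := con 1 :+ q′ :* (b :+ a)) refl q carry c) ⟩
    (1 + q * (c + carry)) % N                ≡⟨ %-cong-+ N refl (m*[n%d]%d≡m*n%d q (c + carry) N) ⟨
    (1 + q * ((c + carry) % N)) % N          ≡⟨ cong (λ x → (1 + q * x) % N) (w-suc k) ⟨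
    (1 + q * w (suc k)) % N
      ≡⟨ cong (λ x → (1 + x) % N) (p^k*x≡p^k*[x%p]+p^[1+k]*[x/p] p (suc k) (w (suc k))) ⟩
    (1 + (q * (w (suc k) % p) + p ^ suc (suc k) * (w (suc k) / p))) % N
      ≡⟨ cong (λ r → (1 + (q * r + p ^ suc (suc k) * (w (suc k) / p))) % N) (w-suc%p≡0 k) ⟩
    (1 + (q * 0 + p ^ suc (suc k) * (w (suc k) / p))) % N
      ≡⟨ cong (λ x → (1 + (x + p ^ suc (suc k) * (w (suc k) / p))) % N) (*-zeroʳ q) ⟩
    (1 + p ^ suc (suc k) * (w (suc k) / p)) % N ∎
    where
    open +-*-Solver
    q = p ^ suc k
    c = conv u s (suc k) (suc (suc k))
    carry = w k / p

  d S : ℕ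
  d = fromDigits p m u
  S = fromDigits p m s

  S<N : S < N
  S<N = fromDigits-< {p} {m} {s} (λ j _ → s<p j)

  d*S%N≡1 : (d * S) % N ≡ 1
  d*S%N≡1 = begin
    (d * S) % N                              ≡⟨ fromDigits-*-% p m u s ⟩
    cauchyProduct p m u s % N                ≡⟨ cauchyProduct-invariant m′ ⟩
    (1 + N * (w m′ / p)) % N                 ≡⟨ cong (λ x → (1 + x) % N) (*-comm N _) ⟩
    (1 + (w m′ / p) * N) % N                 ≡⟨ [m+kn]%n≡m%n 1 (w m′ / p) N ⟩
    1 % N                                    ≡⟨ m<n⇒m%n≡m 1<N ⟩
    1                                        ∎

-- Primality is used only for p ≠ 0.
lemma3p4 : (p m : ℕ) → Prime p → 1 ≤ m →
    (u : ℕ → ℕ) → (∀ k → k < m → u k < p) → u 0 ≢ 0 →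
    (inv : ℕ) → 1 ≤ inv → inv < p → (u 0 * inv) mod p ≡ 1 →
    (Σ ℕ (λ e → e < p ^ m × (fromDigits p m u * e) mod (p ^ m) ≡ 1))
    × (∀ e → e < p ^ m → (fromDigits p m u * e) mod (p ^ m) ≡ 1 →
         e ≡ fromDigits p m (sSeq p m u inv))
lemma3p4 p zero _ () _ _ _ _ _ _ _
lemma3p4 p (suc m′) p-prime _ u _ _ inv _ _ u₀inv≡1 =
  (S , S<N , trans (mod≡% (d * S) N) d*S%N≡1) , S-unique
  where
  instance
    p≢0 : NonZero p
    p≢0 = prime⇒nonZero p-prime
  open Inverse p m′ u inv (trans (sym (mod≡% (u 0 * inv) p)) u₀inv≡1)
  S-unique : ∀ e → e < N → (d * e) mod N ≡ 1 → e ≡ S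
  S-unique e e<N de≡1 = %-inverse-unique {d} e<N S<N (trans (sym (mod≡% (d * e) N)) de≡1) d*S%N≡1
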